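{- Let $p$ be a prime, let $A$ be a matrix over $GF(p)$ whose columns are labelled by a finite set $E$, let $M=M[A]$, let $a,b\in E$ be distinct, $\alpha\in GF(p)\setminus\{0\}$, and let $M_{a,b}$ be the splitting matroid. If $M_{a,b}$ is Eulerian and has a partition of its ground set into circuits of $M_{a,b}$ none of which belongs to $\mathcal{C}_1$, then $M$ is Eulerian.
   Context: A matroid is Eulerian if its ground set is a disjoint union of circuits. The splitting matroid $M_{a,b}$ is $M[A_{a,b}]$, where $A_{a,b}$ is $A$ with an appended row having entries $\alpha$ in columns $a,b$ and $0$ elsewhere. For a circuit $C$ of $M$, its columns satisfy $\sum_{u\in C}c_u u=0$ over $GF(p)$ with all $c_u\ne0$ (unique up to nonzero scalar). $C$ is a $p$-circuit if $a,b\in C$ and $c_a+c_b=0$; an $np$-circuit if $|C\cap\{a,b\}|=1$, or $a,b\in C$ and $c_a+c_b\ne0$. Let $\mathcal{C}_0$ be the set of circuits of $M$ that are $p$-circuits or disjoint from $\{a,b\}$. A set $C\cup I$, with $C$ an $np$-circuit of $M$, $I$ independent in $M$, $C\cap I=\emptyset$, $\{a,b\}\subseteq C\cup I$, is $p$-dependent if it contains no member of $\mathcal{C}_0$ and there are nonzero scalars $\beta_x$ ($x\in C\cup I$) with $\sum\beta_x x=0$ and $\beta_a+\beta_b=0$. $\mathcal{C}_1$ is the set of inclusion-minimal $p$-dependent sets $C\cup I$ that contain no union $C_1'\cup C_2'$ of two disjoint $np$-circuits of $M$. -}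

module Defs where

open import Data.Nat using (ℕ; zero; suc; _+_; _*_)
open import Data.Nat.Divisibility using (_∣_)
open import Data.Fin using (Fin; zero; suc; _≟_)
open import Data.Fin.Subset using (Subset; _∈_; _∉_; _⊆_; _⊂_; _∩_; _∪_; Empty)
open import Data.Bool using (if_then_else_; _∨_)
open import Data.Product using (Σ; ∃; _×_)
open import Data.Sum using (_⊎_)
open import Data.List using (List)
open import Data.List.Relation.Unary.All using (All)
open import Data.List.Relation.Unary.Any using (Any)
open import Data.List.Relation.Unary.AllPairs using (AllPairs)
open import Relation.Nullary using (¬_)
open import Relation.Nullary.Decidable using (⌊_⌋)
open import Relation.Binary.PropositionalEquality using (_≡_)

-- Convention: GF(p) is represented by natural-number representatives;
-- an element x is zero in GF(p) iff p ∣ x.  Matrices over GF(p) with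
-- m rows and columns labelled by E = Fin n are functions Fin m → Fin n → ℕ.

Matrix : ℕ → ℕ → Set
Matrix m n = Fin m → Fin n → ℕ

sumFin : ∀ {n} → (Fin n → ℕ) → ℕ
sumFin {zero}  f = 0
sumFin {suc n} f = f zero + sumFin (λ i → f (suc i))

LinRel : ∀ {m n} → ℕ → Matrix m n → (Fin n → ℕ) → Set
LinRel p A c = ∀ i → p ∣ sumFin (λ u → c u * A i u)

Dependent : ∀ {m n} → ℕ → Matrix m n → Subset n → Set
Dependent p A S =
  Σ _ λ (c : _ → ℕ) → (∀ u → u ∉ S → p ∣ c u) × (∃ λ u → u ∈ S × ¬ (p ∣ c u)) × LinRel p A c

Independent : ∀ {m n} → ℕ → Matrix m n → Subset n → Set
Independent p A S = ¬ Dependent p A S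

Circuit : ∀ {m n} → ℕ → Matrix m n → Subset n → Set
Circuit p A C = Dependent p A C × (∀ D → D ⊂ C → Independent p A D)

SupportedRel : ∀ {m n} → ℕ → Matrix m n → Subset n → (Fin n → ℕ) → Set
SupportedRel p A S c = (∀ u → u ∈ S → ¬ (p ∣ c u)) × (∀ u → u ∉ S → p ∣ c u) × LinRel p A c

PCircuit : ∀ {m n} → ℕ → Matrix m n → Fin n → Fin n → Subset n → Set
PCircuit p A a b C = Circuit p A C × a ∈ C × b ∈ C ×
  Σ _ λ (c : _ → ℕ) → SupportedRel p A C c × (p ∣ c a + c b)

NPCircuit : ∀ {m n} → ℕ → Matrix m n → Fin n → Fin n → Subset n → Set
NPCircuit p A a b C = Circuit p A C ×
  ((a ∈ C × b ∉ C) ⊎ (a ∉ C × b ∈ C) ⊎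
   (a ∈ C × b ∈ C × Σ _ λ (c : _ → ℕ) → SupportedRel p A C c × ¬ (p ∣ c a + c b)))

InC0 : ∀ {m n} → ℕ → Matrix m n → Fin n → Fin n → Subset n → Set
InC0 p A a b C = Circuit p A C × (PCircuit p A a b C ⊎ (a ∉ C × b ∉ C))

PDependent : ∀ {m n} → ℕ → Matrix m n → Fin n → Fin n → Subset n → Set
PDependent p A a b S =
  Σ _ λ C → Σ _ λ I →
    NPCircuit p A a b C × Independent p A I × Empty (C ∩ I) × S ≡ C ∪ I ×
    a ∈ S × b ∈ S ×
    (∀ D → D ⊆ S → ¬ InC0 p A a b D) ×
    (Σ _ λ (β : _ → ℕ) → SupportedRel p A S β × (p ∣ β a + β b))

InC1 : ∀ {m n} → ℕ → Matrix m n → Fin n → Fin n → Subset n → Set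
InC1 p A a b S =
  PDependent p A a b S ×
  (∀ T → T ⊂ S → ¬ PDependent p A a b T) ×
  ¬ (Σ _ λ C₁ → Σ _ λ C₂ → NPCircuit p A a b C₁ × NPCircuit p A a b C₂ ×
       Empty (C₁ ∩ C₂) × (C₁ ∪ C₂) ⊆ S)

splitMatrix : ∀ {m n} → Matrix m n → Fin n → Fin n → ℕ → Matrix (suc m) n
splitMatrix A a b α zero    u = if ⌊ u ≟ a ⌋ ∨ ⌊ u ≟ b ⌋ then α else 0
splitMatrix A a b α (suc i) u = A i u

CircuitPartition : ∀ {m n} → ℕ → Matrix m n → List (Subset n) → Set
CircuitPartition {n = n} p A Cs =
  All (Circuit p A) Cs × AllPairs (λ X Y → Empty (X ∩ Y)) Cs × (∀ (x : Fin n) → Any (x ∈_) Cs)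

Eulerian : ∀ {m n} → ℕ → Matrix m n → Set
Eulerian p A = ∃ λ Cs → CircuitPartition p A Cs

-- Every circuit D of M_{a,b} outside 𝒞₁ is a circuit of M or the disjoint union of two
-- circuits of M, so splitting the blocks of the given partition yields a circuit partition
-- of M.  Restricted to the rows of A, D is M-dependent.  If D properly contains an
-- M-circuit C, then C is an np-circuit, and D ∖ C is M-independent: an M-circuit C' inside
-- it would be, like C, independent in M_{a,b}, and a combination of the relations of C and
-- C' cancelling the extra row would make C ∪ C' dependent in M_{a,b}, so C ∪ C' = D.
-- Hence, unless D is such a union, the relation of D exhibits D as a minimal p-dependent
-- set without two disjoint np-circuits, i.e. D ∈ 𝒞₁.
module Submission where

open import Defs
open import Data.Bool using (if_then_else_)
open import Data.Empty using (⊥; ⊥-elim)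
open import Data.Fin using (Fin; zero; suc; toℕ; fromℕ<; _≟_)
open import Data.Fin.Properties using (any?; all?; toℕ-fromℕ<)
open import Data.Fin.Subset using (Subset; _∈_; _∉_; _⊆_; _⊂_; _∩_; _∪_; _-_; ∁; ∣_∣; Empty)
open import Data.Fin.Subset.Properties
  using (_∈?_; _⊂?_; anySubset?; nonempty?; ⊆-antisym; ⊆-trans; ⊆-⊂-trans; p⊂q⇒∣p∣<∣q∣;
         x∈p∩q⁺; x∈p∩q⁻; x∈p∪q⁺; x∈p∪q⁻; p∩q⊆p; x∈∁p⇒x∉p; x∉p⇒x∈∁p;
         x∈p⇒p-x⊂p; x∈p∧x≢y⇒x∈p-y)
open import Data.List using (List; []; _∷_)
open import Data.List.Relation.Unary.All as All using (All; []; _∷_)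
open import Data.List.Relation.Unary.Any using (Any; here; there)
open import Data.List.Relation.Unary.AllPairs using (AllPairs; []; _∷_)
open import Data.Nat using (ℕ; zero; suc; _+_; _*_; _%_; _<_; pred; NonZero)
open import Data.Nat.DivMod using (m%n<n; m%n%n≡m%n; %-distribˡ-+; %-distribˡ-*)
open import Data.Nat.Divisibility
  using (_∣_; _∣?_; m%n≡0⇒n∣m; n∣m⇒m%n≡0; ∣m∣n⇒∣m+n; ∣m+n∣m⇒∣n; ∣m⇒∣m*n; ∣n⇒∣m*n; m∣m*n)
open import Data.Nat.Induction using (<-wellFounded)
open import Data.Nat.Primality using (Prime; prime⇒nonZero; euclidsLemma)
open import Data.Nat.Properties using (+-*-semiring; +-comm; +-identityʳ; *-zeroʳ; *-distribʳ-+; suc-pred)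
open import Data.Nat.Tactic.RingSolver using (solve-∀)
open import Data.Product using (Σ; ∃; _×_; _,_; proj₁; proj₂)
open import Data.Sum using (_⊎_; inj₁; inj₂; [_,_]; [_,_]′)
open import Data.Vec using (Vec; []; _∷_; lookup; tabulate)
open import Data.Vec.Properties using (lookup∘tabulate; ≡-dec)
open import Function using (_∘_; _on_; id)
open import Induction.WellFounded using (Acc; acc)
open import Relation.Binary.Construct.On using (wellFounded)
open import Relation.Binary.PropositionalEquality
  using (_≡_; _≢_; _≗_; refl; sym; trans; cong; cong₂; subst; module ≡-Reasoning)
open import Relation.Nullary using (¬_; Dec; yes; no)
open import Relation.Nullary.Decidable using (⌊_⌋; map′; _×-dec_; _→-dec_; ¬?; decidable-stable)
import Data.Bool.Properties as Bool
open import Algebra.Properties.Semiring.Sum +-*-semiring using (sum; ∑-distrib-+; *-distribˡ-sum; sum-replicate-zero)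

open ≡-Reasoning

sumFin≡sum : ∀ {n} (f : Fin n → ℕ) → sumFin f ≡ sum f
sumFin≡sum {zero}  f = refl
sumFin≡sum {suc n} f = cong (f zero +_) (sumFin≡sum (f ∘ suc))

sumFin-cong : ∀ {n} {f g : Fin n → ℕ} → f ≗ g → sumFin f ≡ sumFin g
sumFin-cong {zero}  f≗g = refl
sumFin-cong {suc n} f≗g = cong₂ _+_ (f≗g zero) (sumFin-cong (f≗g ∘ suc))

sumFin-+ : ∀ {n} (f g : Fin n → ℕ) → sumFin (λ u → f u + g u) ≡ sumFin f + sumFin g
sumFin-+ f g = begin
  sumFin (λ u → f u + g u) ≡⟨ sumFin≡sum (λ u → f u + g u) ⟩
  sum (λ u → f u + g u)    ≡⟨ ∑-distrib-+ f g ⟩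
  sum f + sum g            ≡⟨ cong₂ _+_ (sumFin≡sum f) (sumFin≡sum g) ⟨
  sumFin f + sumFin g      ∎

sumFin-*ˡ : ∀ {n} k (f : Fin n → ℕ) → sumFin (λ u → k * f u) ≡ k * sumFin f
sumFin-*ˡ k f = begin
  sumFin (λ u → k * f u) ≡⟨ sumFin≡sum (λ u → k * f u) ⟩
  sum (λ u → k * f u)    ≡⟨ *-distribˡ-sum k f ⟨
  k * sum f              ≡⟨ cong (k *_) (sumFin≡sum f) ⟨
  k * sumFin f           ∎

sumFin-zero : ∀ n → sumFin {n} (λ _ → 0) ≡ 0
sumFin-zero n = trans (sumFin≡sum {n} (λ _ → 0)) (sum-replicate-zero n)

≟-suc : ∀ {n} (i j : Fin n) → ⌊ suc i ≟ suc j ⌋ ≡ ⌊ i ≟ j ⌋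
≟-suc i j with i ≟ j
... | yes _ = refl
... | no  _ = refl

sumFin-δ : ∀ {n} (f : Fin n → ℕ) (x : Fin n) → sumFin (λ u → if ⌊ u ≟ x ⌋ then f u else 0) ≡ f x
sumFin-δ {suc n} f zero    = trans (cong (f zero +_) (sumFin-zero n)) (+-identityʳ (f zero))
sumFin-δ {suc n} f (suc x) =
  trans (sumFin-cong (λ u → cong (λ t → if t then f (suc u) else 0) (≟-suc u x))) (sumFin-δ (f ∘ suc) x)

DependentVia : ∀ {m n} → ℕ → Matrix m n → Subset n → (Fin n → ℕ) → Set
DependentVia p A S c = (∀ u → u ∉ S → p ∣ c u) × (∃ λ u → u ∈ S × ¬ (p ∣ c u)) × LinRel p A c

*-distribʳ-combination : ∀ k l x y z → (k * x + l * y) * z ≡ k * (x * z) + l * (y * z)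
*-distribʳ-combination = solve-∀

LinRel-combination : ∀ {p m n} (A : Matrix m n) {r r' : Fin n → ℕ} k l →
  LinRel p A r → LinRel p A r' → LinRel p A (λ u → k * r u + l * r' u)
LinRel-combination {p} A {r} {r'} k l rel rel' i =
  subst (p ∣_) (sym expand) (∣m∣n⇒∣m+n (∣n⇒∣m*n k (rel i)) (∣n⇒∣m*n l (rel' i)))
  where
  term term' : Fin _ → ℕ
  term  u = r u * A i u
  term' u = r' u * A i u
  expand : sumFin (λ u → (k * r u + l * r' u) * A i u) ≡ k * sumFin term + l * sumFin term'
  expand = begin
    sumFin (λ u → (k * r u + l * r' u) * A i u)
      ≡⟨ sumFin-cong (λ u → *-distribʳ-combination k l (r u) (r' u) (A i u)) ⟩
    sumFin (λ u → k * term u + l * term' u)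
      ≡⟨ sumFin-+ (λ u → k * term u) (λ u → l * term' u) ⟩
    sumFin (λ u → k * term u) + sumFin (λ u → l * term' u)
      ≡⟨ cong₂ _+_ (sumFin-*ˡ k term) (sumFin-*ˡ l term') ⟩
    k * sumFin term + l * sumFin term' ∎

extraRow-sum : ∀ {m n} (A : Matrix m n) {a b : Fin n} → a ≢ b → (α : ℕ) (c : Fin n → ℕ) →
  sumFin (λ u → c u * splitMatrix A a b α zero u) ≡ (c a + c b) * α
extraRow-sum {n = n} A {a} {b} a≢b α c = begin
  sumFin (λ u → c u * splitMatrix A a b α zero u) ≡⟨ sumFin-cong split ⟩
  sumFin (λ u → δ a u + δ b u)                    ≡⟨ sumFin-+ (δ a) (δ b) ⟩
  sumFin (δ a) + sumFin (δ b)                     ≡⟨ cong₂ _+_ (sumFin-δ _ a) (sumFin-δ _ b) ⟩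
  c a * α + c b * α                               ≡⟨ *-distribʳ-+ α (c a) (c b) ⟨
  (c a + c b) * α                                 ∎
  where
  δ : Fin n → Fin n → ℕ
  δ x u = if ⌊ u ≟ x ⌋ then c u * α else 0
  split : ∀ u → c u * splitMatrix A a b α zero u ≡ δ a u + δ b u
  split u with u ≟ a | u ≟ b
  ... | yes u≡a | yes u≡b = ⊥-elim (a≢b (trans (sym u≡a) u≡b))
  ... | yes _   | no  _   = sym (+-identityʳ _)
  ... | no  _   | yes _   = refl
  ... | no  _   | no  _   = *-zeroʳ (c u)

minimal-dependent⇒full-support : ∀ {p m n} {B : Matrix m n} {X c} →
  (∀ T → T ⊂ X → Independent p B T) → DependentVia p B X c → ∀ u → u ∈ X → ¬ (p ∣ c u)
minimal-dependent⇒full-support {p} {X = X} {c} minimal (out , (v , v∈X , c∤v) , rel) u u∈X p∣cu =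
  minimal _ (x∈p⇒p-x⊂p u∈X) (c , out' , (v , x∈p∧x≢y⇒x∈p-y v∈X v≢u , c∤v) , rel)
  where
  v≢u : v ≢ u
  v≢u refl = c∤v p∣cu
  out' : ∀ w → w ∉ X - u → p ∣ c w
  out' w w∉ with w ≟ u
  ... | yes refl = p∣cu
  ... | no  w≢u  = out w (λ w∈X → w∉ (x∈p∧x≢y⇒x∈p-y w∈X w≢u))

minimal-dependent⇒supported : ∀ {p m n} {B : Matrix m n} {X c} →
  (∀ T → T ⊂ X → Independent p B T) → DependentVia p B X c → SupportedRel p B X c
minimal-dependent⇒supported minimal dep@(out , _ , rel) = minimal-dependent⇒full-support minimal dep , out , rel

∈-partner : ∀ {p m n} {B : Matrix m n} {S c} {x y : Fin n} →
  SupportedRel p B S c → p ∣ c x + c y → x ∈ S → y ∈ S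
∈-partner {p} {S = S} {c} {x} {y} (full , out , _) p∣ x∈S =
  decidable-stable (y ∈? S) (λ y∉S → full x x∈S (∣m+n∣m⇒∣n (subst (p ∣_) (+-comm (c x) (c y)) p∣) (out y y∉S)))

∃-Vec? : ∀ {k} n {P : Vec (Fin k) n → Set} → (∀ v → Dec (P v)) → Dec (∃ P)
∃-Vec? zero    P? = map′ ([] ,_) (λ { ([] , pv) → pv }) (P? [])
∃-Vec? (suc n) P? = map′ (λ { (x , v , pv) → x ∷ v , pv }) (λ { (x ∷ v , pv) → x , v , pv })
  (any? (λ x → ∃-Vec? n (P? ∘ (x ∷_))))

module Decidability (p : ℕ) .{{_ : NonZero p}} where

  ∣-resp-≡% : ∀ {x y} → x % p ≡ y % p → p ∣ x → p ∣ y
  ∣-resp-≡% {x} {y} x≡y p∣x = m%n≡0⇒n∣m y p (trans (sym x≡y) (n∣m⇒m%n≡0 x p p∣x))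

  *-≡%-congʳ : ∀ {x y} z → x % p ≡ y % p → (x * z) % p ≡ (y * z) % p
  *-≡%-congʳ {x} {y} z x≡y = begin
    (x * z) % p           ≡⟨ %-distribˡ-* x z p ⟩
    (x % p * (z % p)) % p ≡⟨ cong (λ t → (t * (z % p)) % p) x≡y ⟩
    (y % p * (z % p)) % p ≡⟨ %-distribˡ-* y z p ⟨
    (y * z) % p           ∎

  sumFin-≡%-cong : ∀ {n} {f g : Fin n → ℕ} → (∀ u → f u % p ≡ g u % p) → sumFin f % p ≡ sumFin g % p
  sumFin-≡%-cong {zero}          f≡g = refl
  sumFin-≡%-cong {suc n} {f} {g} f≡g = begin
    (f zero + sumFin (f ∘ suc)) % p             ≡⟨ %-distribˡ-+ (f zero) _ p ⟩
    (f zero % p + sumFin (f ∘ suc) % p) % p     ≡⟨ cong₂ (λ s t → (s + t) % p) (f≡g zero) (sumFin-≡%-cong (f≡g ∘ suc)) ⟩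
    (g zero % p + sumFin (g ∘ suc) % p) % p     ≡⟨ %-distribˡ-+ (g zero) _ p ⟨
    (g zero + sumFin (g ∘ suc)) % p             ∎

  DependentVia-≡%-cong : ∀ {m n} {A : Matrix m n} {S c c'} →
    (∀ u → c u % p ≡ c' u % p) → DependentVia p A S c → DependentVia p A S c'
  DependentVia-≡%-cong {A = A} c≡c' (out , (u , u∈S , c∤u) , rel) =
      (λ w w∉S → ∣-resp-≡% (c≡c' w) (out w w∉S))
    , (u , u∈S , c∤u ∘ ∣-resp-≡% (sym (c≡c' u)))
    , (λ i → ∣-resp-≡% (sumFin-≡%-cong (λ w → *-≡%-congʳ (A i w) (c≡c' w))) (rel i))

  residues : ∀ {n} → (Fin n → ℕ) → Vec (Fin p) n
  residues c = tabulate (λ u → fromℕ< (m%n<n (c u) p))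

  residues-≡% : ∀ {n} (c : Fin n → ℕ) u → c u % p ≡ toℕ (lookup (residues c) u) % p
  residues-≡% c u = begin
    c u % p                              ≡⟨ m%n%n≡m%n (c u) p ⟨
    c u % p % p                          ≡⟨ cong (_% p) (toℕ-fromℕ< (m%n<n (c u) p)) ⟨
    toℕ (fromℕ< (m%n<n (c u) p)) % p     ≡⟨ cong (λ i → toℕ i % p) (lookup∘tabulate _ u) ⟨
    toℕ (lookup (residues c) u) % p      ∎

  -- A relation may be replaced by its residues mod p, so it suffices to search Fin p ^ n.
  dependent? : ∀ {m n} (A : Matrix m n) S → Dec (Dependent p A S)
  dependent? {n = n} A S =
    map′ (λ { (v , dep) → _ , dep })
         (λ { (c , dep) → residues c , DependentVia-≡%-cong (residues-≡% c) dep })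
         (∃-Vec? n (λ v → dependentVia? (λ u → toℕ (lookup v u))))
    where
    dependentVia? : ∀ c → Dec (DependentVia p A S c)
    dependentVia? c = all? (λ u → ¬? (u ∈? S) →-dec (p ∣? c u))
               ×-dec any? (λ u → (u ∈? S) ×-dec ¬? (p ∣? c u))
               ×-dec all? (λ i → p ∣? sumFin (λ u → c u * A i u))

  properDependent? : ∀ {m n} (B : Matrix m n) D → Dec (∃ λ T → T ⊂ D × Dependent p B T)
  properDependent? B D = anySubset? (λ T → T ⊂? D ×-dec dependent? B T)

  circuit? : ∀ {m n} (B : Matrix m n) C → Dec (Circuit p B C)
  circuit? B C = dependent? B C ×-dec
    map′ (λ none T T⊂C dT → none (T , T⊂C , dT)) (λ minimal (T , T⊂C , dT) → minimal T T⊂C dT)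
         (¬? (properDependent? B C))

  dependent⇒⊇circuit : ∀ {m n} (B : Matrix m n) {T} → Dependent p B T → ∃ λ C → C ⊆ T × Circuit p B C
  dependent⇒⊇circuit B {T} = go T (wellFounded ∣_∣ <-wellFounded T)
    where
    go : ∀ T → Acc (_<_ on ∣_∣) T → Dependent p B T → ∃ λ C → C ⊆ T × Circuit p B C
    go T (acc smaller) dT with properDependent? B T
    ... | no none = T , id , dT , λ T' T'⊂T dT' → none (T' , T'⊂T , dT')
    ... | yes (T' , T'⊂T , dT') with go T' (smaller (p⊂q⇒∣p∣<∣q∣ T'⊂T)) dT'
    ...   | C , C⊆T' , C-circuit = C , ⊆-trans C⊆T' (proj₁ T'⊂T) , C-circuit

Disjoint : ∀ {n} → Subset n → Subset n → Set
Disjoint X Y = Empty (X ∩ Y)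

Disjoint-mono : ∀ {n} {X Y X' Y' : Subset n} → Disjoint X Y → X' ⊆ X → Y' ⊆ Y → Disjoint X' Y'
Disjoint-mono {X' = X'} {Y'} disj X'⊆X Y'⊆Y (x , x∈) with x∈p∩q⁻ X' Y' x∈
... | x∈X' , x∈Y' = disj (x , x∈p∩q⁺ (X'⊆X x∈X' , Y'⊆Y x∈Y'))

DisjointUnionOf : ∀ {n} → (Subset n → Set) → Subset n → Set
DisjointUnionOf Good D = Σ _ λ C₁ → Σ _ λ C₂ → Good C₁ × Good C₂ × Disjoint C₁ C₂ × C₁ ∪ C₂ ≡ D

∪-⊆ : ∀ {n} {X Y Z : Subset n} → X ⊆ Z → Y ⊆ Z → X ∪ Y ⊆ Z
∪-⊆ {X = X} {Y} X⊆Z Y⊆Z x∈ = [ X⊆Z , Y⊆Z ] (x∈p∪q⁻ X Y x∈)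

⊆⇒≡⊎⊂ : ∀ {n} {X D : Subset n} → X ⊆ D → X ≡ D ⊎ X ⊂ D
⊆⇒≡⊎⊂ {X = X} {D} X⊆D with any? (λ x → (x ∈? D) ×-dec ¬? (x ∈? X))
... | yes (x , x∈D , x∉X) = inj₂ (X⊆D , x , x∈D , x∉X)
... | no none = inj₁ (⊆-antisym X⊆D (λ {x} x∈D → decidable-stable (x ∈? X) (λ x∉X → none (x , x∈D , x∉X))))

⊆-complement : ∀ {n} {C D : Subset n} → C ⊆ D → D ≡ C ∪ (D ∩ ∁ C)
⊆-complement {C = C} {D} C⊆D = ⊆-antisym (λ x∈D → x∈p∪q⁺ (split x∈D)) (∪-⊆ C⊆D (p∩q⊆p D (∁ C)))
  where
  split : ∀ {x} → x ∈ D → x ∈ C ⊎ x ∈ D ∩ ∁ C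
  split {x} x∈D with x ∈? C
  ... | yes x∈C = inj₁ x∈C
  ... | no  x∉C = inj₂ (x∈p∩q⁺ (x∈D , x∉p⇒x∈∁p x∉C))

Disjoint-complement : ∀ {n} (C D : Subset n) → Disjoint C (D ∩ ∁ C)
Disjoint-complement C D (x , x∈) with x∈p∩q⁻ C _ x∈
... | x∈C , x∈D∖C = x∈∁p⇒x∉p (proj₂ (x∈p∩q⁻ D (∁ C) x∈D∖C)) x∈C

module Refinement {n : ℕ} (Good : Subset n → Set) where

  Refines : List (Subset n) → List (Subset n) → Set
  Refines Ls Cs = All (λ L → Any (L ⊆_) Cs) Ls

  Disjoint-refines : ∀ {D X Cs Ls} → X ⊆ D → All (Disjoint D) Cs → Refines Ls Cs → All (Disjoint X) Ls
  Disjoint-refines {D} {X} X⊆D disj = All.map (go disj)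
    where
    go : ∀ {Cs L} → All (Disjoint D) Cs → Any (L ⊆_) Cs → Disjoint X L
    go (d ∷ _)  (here L⊆C) = Disjoint-mono d X⊆D L⊆C
    go (_ ∷ ds) (there L⊆) = go ds L⊆

  refine : ∀ Cs → All (λ D → Good D ⊎ DisjointUnionOf Good D) Cs →
    ∃ λ Ls → All Good Ls × Refines Ls Cs × (∀ {x} → Any (x ∈_) Cs → Any (x ∈_) Ls) ×
             (AllPairs Disjoint Cs → AllPairs Disjoint Ls)
  refine [] [] = [] , [] , [] , id , (λ _ → [])
  refine (D ∷ Cs) (inj₁ good ∷ splits) with refine Cs splits
  ... | Ls , goods , refines , covers , disjoint =
    D ∷ Ls , good ∷ goods , here id ∷ All.map there refines ,
    (λ { (here x∈D) → here x∈D ; (there x∈) → there (covers x∈) }) ,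
    λ { (d ∷ ds) → Disjoint-refines id d refines ∷ disjoint ds }
  refine (D ∷ Cs) (inj₂ (C₁ , C₂ , good₁ , good₂ , disj , C₁∪C₂≡D) ∷ splits) with refine Cs splits
  ... | Ls , goods , refines , covers , disjoint =
    C₁ ∷ C₂ ∷ Ls , good₁ ∷ good₂ ∷ goods , here C₁⊆D ∷ here C₂⊆D ∷ All.map there refines ,
    (λ { (here x∈D) → [ here , there ∘ here ]′ (x∈p∪q⁻ C₁ C₂ (subst (_ ∈_) (sym C₁∪C₂≡D) x∈D))
       ; (there x∈) → there (there (covers x∈)) }) ,
    λ { (d ∷ ds) → (disj ∷ Disjoint-refines C₁⊆D d refines) ∷ Disjoint-refines C₂⊆D d refines ∷ disjoint ds }
    where
    C₁⊆D : C₁ ⊆ D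
    C₁⊆D x∈ = subst (_ ∈_) C₁∪C₂≡D (x∈p∪q⁺ (inj₁ x∈))
    C₂⊆D : C₂ ⊆ D
    C₂⊆D x∈ = subst (_ ∈_) C₁∪C₂≡D (x∈p∪q⁺ (inj₂ x∈))

cancelling-combination : ∀ q x y x' y' →
  ((x' + y') * x + q * (x + y) * x') + ((x' + y') * y + q * (x + y) * y') ≡ suc q * ((x + y) * (x' + y'))
cancelling-combination = solve-∀

module SplittingMatroid {p : ℕ} (p-prime : Prime p) {m n} (A : Matrix m n) {a b : Fin n} (a≢b : a ≢ b)
                        {α : ℕ} (p∤α : ¬ (p ∣ α)) where

  private instance
    p≢0 : NonZero p
    p≢0 = prime⇒nonZero p-prime

  open Decidability p

  Aₐᵦ : Matrix (suc m) n
  Aₐᵦ = splitMatrix A a b α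

  ∣extraRow⇒∣ca+cb : ∀ c → p ∣ sumFin (λ u → c u * Aₐᵦ zero u) → p ∣ c a + c b
  ∣extraRow⇒∣ca+cb c p∣ with euclidsLemma (c a + c b) α p-prime (subst (p ∣_) (extraRow-sum A a≢b α c) p∣)
  ... | inj₁ p∣c = p∣c
  ... | inj₂ p∣α = ⊥-elim (p∤α p∣α)

  dependent-split : ∀ {S c} → DependentVia p A S c → p ∣ c a + c b → Dependent p Aₐᵦ S
  dependent-split {c = c} (out , nz , rel) p∣ =
    c , out , nz , λ { zero → subst (p ∣_) (sym (extraRow-sum A a≢b α c)) (∣m⇒∣m*n α p∣) ; (suc i) → rel i }

  split-dependent⇒dependent : ∀ {S} → Dependent p Aₐᵦ S → Dependent p A S
  split-dependent⇒dependent (c , out , nz , rel) = c , out , nz , rel ∘ suc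

  split-independent⇒∤ : ∀ {S c} → Independent p Aₐᵦ S → DependentVia p A S c → ¬ (p ∣ c a + c b)
  split-independent⇒∤ ind dep p∣ = ind (dependent-split dep p∣)

  supported⇒split-dependent : ∀ {S c u} → u ∈ S → SupportedRel p A S c → p ∣ c a + c b → Dependent p Aₐᵦ S
  supported⇒split-dependent u∈S (full , out , rel) = dependent-split (out , (_ , u∈S , full _ u∈S) , rel)

  C₀⇒split-dependent : ∀ {E} → InC0 p A a b E → Dependent p Aₐᵦ E
  C₀⇒split-dependent (_ , inj₁ (_ , a∈E , _ , _ , supported , p∣)) = supported⇒split-dependent a∈E supported p∣
  C₀⇒split-dependent (((_ , dep) , _) , inj₂ (a∉E , b∉E)) =
    dependent-split dep (∣m∣n⇒∣m+n (proj₁ dep a a∉E) (proj₁ dep b b∉E))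

  independent-circuit⇒np : ∀ {C} → Circuit p A C → Independent p Aₐᵦ C → NPCircuit p A a b C
  independent-circuit⇒np {C} circuit@((r , dep) , minimal) ind with a ∈? C | b ∈? C
  ... | yes a∈C | yes b∈C = circuit , inj₂ (inj₂ (a∈C , b∈C , r , minimal-dependent⇒supported minimal dep ,
                                                   split-independent⇒∤ ind dep))
  ... | yes a∈C | no b∉C  = circuit , inj₁ (a∈C , b∉C)
  ... | no a∉C  | yes b∈C = circuit , inj₂ (inj₁ (a∉C , b∈C))
  ... | no a∉C  | no b∉C  =
    ⊥-elim (split-independent⇒∤ ind dep (∣m∣n⇒∣m+n (proj₁ dep a a∉C) (proj₁ dep b b∉C)))

  npCircuit-meets : ∀ {C} → NPCircuit p A a b C → a ∈ C ⊎ b ∈ C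
  npCircuit-meets (_ , inj₁ (a∈C , _))        = inj₁ a∈C
  npCircuit-meets (_ , inj₂ (inj₁ (_ , b∈C))) = inj₂ b∈C
  npCircuit-meets (_ , inj₂ (inj₂ (a∈C , _))) = inj₁ a∈C

  -- γ = s'·r − s·r' (with pred p for −1) kills the extra row, which takes the value s·α on r;
  -- s and s' are nonzero mod p because C and C' are independent in M_{a,b}.
  disjoint-union-dependent : ∀ {C C'} → Dependent p A C → Dependent p A C' →
    Independent p Aₐᵦ C → Independent p Aₐᵦ C' → Disjoint C C' → Dependent p Aₐᵦ (C ∪ C')
  disjoint-union-dependent {C} {C'} (r , dep@(out , (u , u∈C , r∤u) , rel)) (r' , dep'@(out' , _ , rel'))
                           ind ind' disj =
    dependent-split (out-γ , (u , x∈p∪q⁺ (inj₁ u∈C) , γ∤u) , LinRel-combination A s' (pred p * s) rel rel') p∣γa+γb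
    where
    s s' : ℕ
    s  = r a + r b
    s' = r' a + r' b
    γ : Fin n → ℕ
    γ w = s' * r w + pred p * s * r' w
    p∣γa+γb : p ∣ γ a + γ b
    p∣γa+γb = subst (p ∣_) (sym (trans (cancelling-combination (pred p) (r a) (r b) (r' a) (r' b))
                                       (cong (_* (s * s')) (suc-pred p))))
                    (m∣m*n (s * s'))
    out-γ : ∀ w → w ∉ C ∪ C' → p ∣ γ w
    out-γ w w∉ = ∣m∣n⇒∣m+n (∣n⇒∣m*n s' (out w (w∉ ∘ x∈p∪q⁺ ∘ inj₁)))
                           (∣n⇒∣m*n (pred p * s) (out' w (w∉ ∘ x∈p∪q⁺ ∘ inj₂)))
    γ∤u : ¬ (p ∣ γ u)
    γ∤u p∣γu with euclidsLemma s' (r u) p-prime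
      (∣m+n∣m⇒∣n (subst (p ∣_) (+-comm (s' * r u) _) p∣γu)
                 (∣n⇒∣m*n (pred p * s) (out' u (λ u∈C' → disj (u , x∈p∩q⁺ (u∈C , u∈C'))))))
    ... | inj₁ p∣s' = split-independent⇒∤ ind' dep' p∣s'
    ... | inj₂ p∣ru = r∤u p∣ru

  twoCircuits? : ∀ D → Dec (DisjointUnionOf (Circuit p A) D)
  twoCircuits? D = anySubset? λ C₁ → anySubset? λ C₂ →
    circuit? A C₁ ×-dec circuit? A C₂ ×-dec ¬? (nonempty? (C₁ ∩ C₂)) ×-dec ≡-dec Bool._≟_ (C₁ ∪ C₂) D

  module _ {D C : Subset n} (D-circuit : Circuit p Aₐᵦ D) (C⊂D : C ⊂ D) (C-circuit : Circuit p A C)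
           (not-two : ¬ DisjointUnionOf (Circuit p A) D) where

    private
      C⊆D : C ⊆ D
      C⊆D = proj₁ C⊂D

      D-minimal : ∀ T → T ⊂ D → Independent p Aₐᵦ T
      D-minimal = proj₂ D-circuit

    circuit⊆D⇒split-independent : ∀ {E} → E ⊆ D → Circuit p A E → Independent p Aₐᵦ E
    circuit⊆D⇒split-independent E⊆D E-circuit with ⊆⇒≡⊎⊂ E⊆D
    ... | inj₁ refl = ⊥-elim (proj₂ E-circuit _ C⊂D (proj₁ C-circuit))
    ... | inj₂ E⊂D  = D-minimal _ E⊂D

    no-disjoint-circuits : ∀ {C₁ C₂} → C₁ ⊆ D → C₂ ⊆ D → Circuit p A C₁ → Circuit p A C₂ → Disjoint C₁ C₂ → ⊥
    no-disjoint-circuits C₁⊆D C₂⊆D circuit₁ circuit₂ disj with ⊆⇒≡⊎⊂ (∪-⊆ C₁⊆D C₂⊆D)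
    ... | inj₁ C₁∪C₂≡D = not-two (_ , _ , circuit₁ , circuit₂ , disj , C₁∪C₂≡D)
    ... | inj₂ C₁∪C₂⊂D = D-minimal _ C₁∪C₂⊂D
      (disjoint-union-dependent (proj₁ circuit₁) (proj₁ circuit₂)
        (circuit⊆D⇒split-independent C₁⊆D circuit₁) (circuit⊆D⇒split-independent C₂⊆D circuit₂) disj)

    complement-independent : Independent p A (D ∩ ∁ C)
    complement-independent dep with dependent⇒⊇circuit A dep
    ... | C' , C'⊆ , C'-circuit = no-disjoint-circuits C⊆D (p∩q⊆p D (∁ C) ∘ C'⊆) C-circuit C'-circuit
                                    (Disjoint-mono (Disjoint-complement C D) id C'⊆)

    C-np : NPCircuit p A a b C
    C-np = independent-circuit⇒np C-circuit (circuit⊆D⇒split-independent C⊆D C-circuit)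

    proper-circuit⇒∈C₁ : InC1 p A a b D
    proper-circuit⇒∈C₁ = p-dependent , minimal , λ (C₁ , C₂ , np₁ , np₂ , disj , C₁∪C₂⊆D) →
      no-disjoint-circuits (C₁∪C₂⊆D ∘ x∈p∪q⁺ ∘ inj₁) (C₁∪C₂⊆D ∘ x∈p∪q⁺ ∘ inj₂) (proj₁ np₁) (proj₁ np₂) disj
      where
      c = proj₁ (proj₁ D-circuit)
      supported : SupportedRel p A D c
      supported with minimal-dependent⇒supported D-minimal (proj₂ (proj₁ D-circuit))
      ... | full , out , rel = full , out , rel ∘ suc
      p∣ca+cb : p ∣ c a + c b
      p∣ca+cb = ∣extraRow⇒∣ca+cb c (proj₂ (proj₂ (proj₂ (proj₁ D-circuit))) zero)
      a∈D×b∈D : a ∈ D × b ∈ D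
      a∈D×b∈D with npCircuit-meets C-np
      ... | inj₁ a∈C = C⊆D a∈C , ∈-partner supported p∣ca+cb (C⊆D a∈C)
      ... | inj₂ b∈C = ∈-partner supported (subst (p ∣_) (+-comm (c a) (c b)) p∣ca+cb) (C⊆D b∈C) , C⊆D b∈C
      p-dependent : PDependent p A a b D
      p-dependent = C , D ∩ ∁ C , C-np , complement-independent , Disjoint-complement C D , ⊆-complement C⊆D ,
                    proj₁ a∈D×b∈D , proj₂ a∈D×b∈D ,
                    (λ E E⊆D inC₀ → circuit⊆D⇒split-independent E⊆D (proj₁ inC₀) (C₀⇒split-dependent inC₀)) ,
                    c , supported , p∣ca+cb
      minimal : ∀ T → T ⊂ D → ¬ PDependent p A a b T
      minimal T T⊂D (_ , _ , _ , _ , _ , _ , a∈T , _ , _ , β , supportedβ , p∣βa+βb) =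
        D-minimal T T⊂D (supported⇒split-dependent a∈T supportedβ p∣βa+βb)

  decompose : ∀ {D} → Circuit p Aₐᵦ D → ¬ InC1 p A a b D → Circuit p A D ⊎ DisjointUnionOf (Circuit p A) D
  decompose {D} D-circuit D∉C₁ with properDependent? A D
  ... | no none = inj₁ (split-dependent⇒dependent (proj₁ D-circuit) , λ T T⊂D dep → none (T , T⊂D , dep))
  ... | yes (T , T⊂D , T-dependent) with dependent⇒⊇circuit A T-dependent | twoCircuits? D
  ...   | _ , _ , _ | yes two = inj₂ two
  ...   | C , C⊆T , C-circuit | no not-two =
    ⊥-elim (D∉C₁ (proper-circuit⇒∈C₁ D-circuit (⊆-⊂-trans C⊆T T⊂D) C-circuit not-two))

mainTheorem11 : (p : ℕ) → Prime p → (m n : ℕ) (A : Matrix m n) (a b : Fin n) → a ≢ b →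
    (α : ℕ) → ¬ (p ∣ α) →
    Eulerian p (splitMatrix A a b α) →
    (∃ λ Cs → CircuitPartition p (splitMatrix A a b α) Cs × All (λ C → ¬ InC1 p A a b C) Cs) →
    Eulerian p A
-- The Eulerian hypothesis is implied by the next one.
mainTheorem11 p p-prime m n A a b a≢b α p∤α _ (Cs , (circuits , disjoint , covers) , ∉C₁)
  with refine Cs (All.zipWith (λ (circuit , D∉C₁) → decompose circuit D∉C₁) (circuits , ∉C₁))
  where
  open SplittingMatroid p-prime A a≢b p∤α
  open Refinement (Circuit p A)
... | Ls , Ls-circuits , _ , covers⇒ , disjoint⇒ = Ls , (Ls-circuits , disjoint⇒ disjoint , covers⇒ ∘ covers)
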